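{- Let $G$ be a finite graph and let $C_1,\dots,C_s$ be cycles of $G$ such that the set $A$ of vertices common to all of $C_1,\dots,C_s$ is nonempty. Then $A$ contains at least one cycle generic vertex. In particular, every cycle of $G$ contains a cycle generic vertex.
   Context: Graphs are finite, loops and multiple edges allowed. A cycle is a closed walk of length $\ge1$ with no repeated edge and no repeated vertex other than its coinciding first and last vertex; cycles are identified with their bodies (subgraphs of their vertices and edges). $\mathrm{Cycle}(G)$ is the set of cycle bodies of $G$ and $\mathrm{Cycle}(v)$ the set of those containing vertex $v$. $G^c$ is the union of all cycle bodies and $\deg_c(v)$ is the degree of $v$ in $G^c$ ($0$ if $v\notin G^c$). A vertex $v$ is cycle generic if $\deg_c(v)\ge3$ or $v$ is maximal for the preorder $v_1\le_* v_2 \iff \mathrm{Cycle}(v_1)\subseteq\mathrm{Cycle}(v_2)$, i.e. there is no vertex $u$ with $\mathrm{Cycle}(v)\subsetneq\mathrm{Cycle}(u)$. -}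

module Defs where

open import Data.Nat using (ℕ; suc)
open import Data.Fin using (Fin; zero; suc; inject₁; fromℕ)
open import Data.Bool using (Bool; true; false)
open import Data.Product using (Σ; ∃; ∃-syntax; _×_; _,_; proj₁; proj₂)
open import Data.Sum using (_⊎_)
open import Relation.Binary.PropositionalEquality using (_≡_; _≢_)
open import Relation.Nullary using (¬_)
open import Function.Definitions using (Injective)

-- A finite graph (loops and multiple edges allowed): vertices Fin nV,
-- edges Fin nE, each edge has two (unordered) endpoints; a loop has
-- equal endpoints.
record Graph : Set where
  field
    nV   : ℕ
    nE   : ℕ
    ends : Fin nE → Fin nV × Fin nV

module _ (G : Graph) where
  open Graph G

  V : Set
  V = Fin nV

  E : Set
  E = Fin nE

  Joins : E → V → V → Set
  Joins e x y = (ends e ≡ (x , y)) ⊎ (ends e ≡ (y , x))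

  -- A cycle: a closed walk  v₀ e₀ v₁ e₁ … e_{k-1} v_k = v₀  of length k = len ≥ 1,
  -- with no repeated edge and no repeated vertex among v₀ … v_{k-1}.
  record Cycle : Set where
    field
      k      : ℕ
      vert   : Fin (suc (suc k)) → V      -- v₀ … v_{len}, len = suc k ≥ 1
      edge   : Fin (suc k) → E
      closed : vert (fromℕ (suc k)) ≡ vert zero
      joins  : ∀ i → Joins (edge i) (vert (inject₁ i)) (vert (suc i))
      edgeInj : Injective _≡_ _≡_ edge
      vertInj : Injective _≡_ _≡_ (λ i → vert (inject₁ i))

  _∈ᵛ_ : V → Cycle → Set
  v ∈ᵛ C = ∃[ i ] Cycle.vert C (inject₁ i) ≡ v

  _∈ᵉ_ : E → Cycle → Set
  e ∈ᵉ C = ∃[ i ] Cycle.edge C i ≡ e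

  _≤*_ : V → V → Set
  v₁ ≤* v₂ = (C : Cycle) → v₁ ∈ᵛ C → v₂ ∈ᵛ C

  _<*_ : V → V → Set
  v₁ <* v₂ = (v₁ ≤* v₂) × ¬ (v₂ ≤* v₁)

  InGc : E → Set
  InGc e = ∃[ C ] e ∈ᵉ C

  -- darts (edge-ends): (e , false) is the first end, (e , true) the second;
  -- a loop contributes two darts at its vertex.
  endpoint : E → Bool → V
  endpoint e false = proj₁ (ends e)
  endpoint e true  = proj₂ (ends e)

  GcDartAt : V → E × Bool → Set
  GcDartAt v (e , b) = (endpoint e b ≡ v) × InGc e

  -- deg_c(v) ≥ 3 : v has at least three distinct darts in G^c
  -- (degree = number of darts, loops counted twice)
  DegC≥3 : V → Set
  DegC≥3 v = ∃[ d₁ ] ∃[ d₂ ] ∃[ d₃ ]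
               (GcDartAt v d₁ × GcDartAt v d₂ × GcDartAt v d₃ ×
                d₁ ≢ d₂ × d₁ ≢ d₃ × d₂ ≢ d₃)

  Maximal* : V → Set
  Maximal* v = ¬ (∃[ u ] v <* u)

  CycleGeneric : V → Set
  CycleGeneric v = DegC≥3 v ⊎ Maximal* v

module Submission where

open import Defs
open import Data.Nat using (ℕ)
open import Data.Fin using (Fin)
open import Data.Product using (∃-syntax; _×_)

open import Data.Nat using (suc; _<_)
open import Data.Nat.Properties using (anyUpTo?)
open import Data.Fin using (zero; suc; inject₁; fromℕ; finToFun; funToFin)
open import Data.Fin.Properties using (any?; all?; _≟_; finToFun-funToFin; injective⇒≤)
open import Data.Fin.Induction using (spo-noetherian)
open import Data.Product using (∃; _,_; proj₁)
open import Data.Product.Properties using (≡-dec)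
open import Data.Sum using (inj₂)
open import Function using (_∘_; flip)
open import Function.Definitions using (Injective)
open import Induction.WellFounded using (WellFounded; Acc; acc)
open import Relation.Binary.Core using (Rel)
open import Relation.Binary.Definitions using (Reflexive; Transitive; Decidable)
open import Relation.Binary.Structures using (IsStrictPartialOrder)
open import Relation.Binary.PropositionalEquality
  using (_≡_; _≗_; refl; sym; trans; isEquivalence; resp₂)
open import Relation.Nullary using (¬_; Dec; yes; no)
open import Relation.Nullary.Decidable using (map′; _×-dec_; _⊎-dec_; _→-dec_; ¬?; decidable-stable)
open import Relation.Unary using (Pred)

-- The set of vertices common to C₁, …, Cₛ is upward closed for ≤*: if a ≤* u, every cycle
-- through a passes through u. Cycles have at most |V| vertices, so whether some cycle
-- through v₁ avoids v₂ is decidable, and ≤* is a decidable preorder on a finite set.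
-- Hence above any common vertex lies a ≤*-maximal one; it is still common to all Cᵢ and
-- cycle generic. The second claim is the case s = 1.

any-fun? : ∀ {m n p} {P : Pred (Fin m → Fin n) p} →
           (∀ {f g} → f ≗ g → P f → P g) → (∀ f → Dec (P f)) → Dec (∃ P)
any-fun? resp P? =
  map′ (λ (c , p) → finToFun c , p)
       (λ (f , p) → funToFin f , resp (sym ∘ finToFun-funToFin f) p)
       (any? (P? ∘ finToFun))

injective? : ∀ {m n} (f : Fin m → Fin n) → Dec (Injective _≡_ _≡_ f)
injective? f =
  map′ (λ inj {i} {j} → inj i j) (λ inj i j → inj)
       (all? λ i → all? λ j → (f i ≟ f j) →-dec (i ≟ j))

injective-resp : ∀ {a b} {A : Set a} {B : Set b} {f g : A → B} →
                 f ≗ g → Injective _≡_ _≡_ f → Injective _≡_ _≡_ g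
injective-resp f≗g inj eq = inj (trans (f≗g _) (trans eq (sym (f≗g _))))

module _ {a r} {A : Set a} {_≲_ : Rel A r} (≲-refl : Reflexive _≲_) (≲-trans : Transitive _≲_) where

  strictPart-isStrictPartialOrder : IsStrictPartialOrder _≡_ (λ x y → x ≲ y × ¬ y ≲ x)
  strictPart-isStrictPartialOrder = record
    { isEquivalence = isEquivalence
    ; irrefl        = λ { refl (_ , ¬x≲x) → ¬x≲x ≲-refl }
    ; trans         = λ (x≲y , ¬y≲x) (y≲z , _) → ≲-trans x≲y y≲z , λ z≲x → ¬y≲x (≲-trans y≲z z≲x)
    ; <-resp-≈      = resp₂ _
    }

maximal-above : ∀ {n r p} {_⊏_ : Rel (Fin n) r} → WellFounded (flip _⊏_) → Decidable _⊏_ →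
                (P : Pred (Fin n) p) → (∀ {x y} → x ⊏ y → P x → P y) →
                ∀ {x} → P x → ∃[ m ] (P m × ¬ (∃[ u ] m ⊏ u))
maximal-above {_⊏_ = _⊏_} wf _⊏?_ P upward {x} = go (wf x)
  where
  go : ∀ {x} → Acc (flip _⊏_) x → P x → ∃[ m ] (P m × ¬ (∃[ u ] m ⊏ u))
  go {x} (acc rs) Px with any? (x ⊏?_)
  ... | yes (u , x⊏u) = go (rs x⊏u) (upward x⊏u Px)
  ... | no  ¬x⊏u      = x , Px , ¬x⊏u

module _ (G : Graph) where
  open Graph G

  Vertices : ℕ → Set
  Vertices k = Fin (suc (suc k)) → V G

  Edges : ℕ → Set
  Edges k = Fin (suc k) → E G

  IsCycle : ∀ k → Vertices k → Edges k → Set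
  IsCycle k vert edge =
      vert (fromℕ (suc k)) ≡ vert zero
    × (∀ i → Joins G (edge i) (vert (inject₁ i)) (vert (suc i)))
    × Injective _≡_ _≡_ edge
    × Injective _≡_ _≡_ (vert ∘ inject₁)

  Visits : ∀ {k} → Vertices k → V G → Set
  Visits vert v = ∃[ i ] vert (inject₁ i) ≡ v

  Separates : V G → V G → ∀ k → Vertices k → Edges k → Set
  Separates v₁ v₂ k vert edge = IsCycle k vert edge × Visits vert v₁ × ¬ Visits vert v₂

  joins? : ∀ e x y → Dec (Joins G e x y)
  joins? e x y = ≡-dec _≟_ _≟_ (ends e) (x , y) ⊎-dec ≡-dec _≟_ _≟_ (ends e) (y , x)

  joins-resp : ∀ {e e′ x x′ y y′} → e ≡ e′ → x ≡ x′ → y ≡ y′ → Joins G e x y → Joins G e′ x′ y′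
  joins-resp refl refl refl j = j

  visits? : ∀ {k} (vert : Vertices k) v → Dec (Visits vert v)
  visits? vert v = any? λ i → vert (inject₁ i) ≟ v

  separates? : ∀ v₁ v₂ k vert edge → Dec (Separates v₁ v₂ k vert edge)
  separates? v₁ v₂ k vert edge =
    (  (vert (fromℕ (suc k)) ≟ vert zero)
    ×-dec all? (λ i → joins? (edge i) (vert (inject₁ i)) (vert (suc i)))
    ×-dec injective? edge
    ×-dec injective? (vert ∘ inject₁))
    ×-dec visits? vert v₁
    ×-dec ¬? (visits? vert v₂)

  separates-resp : ∀ {v₁ v₂ k} {vert vert′ : Vertices k} {edge edge′ : Edges k} →
                   vert ≗ vert′ → edge ≗ edge′ →
                   Separates v₁ v₂ k vert edge → Separates v₁ v₂ k vert′ edge′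
  separates-resp v≗ e≗ ((closed , joins , edgeInj , vertInj) , (i , vᵢ≡v₁) , ¬visits₂) =
    ( ( trans (sym (v≗ _)) (trans closed (v≗ zero))
      , (λ i → joins-resp (e≗ i) (v≗ _) (v≗ _) (joins i))
      , injective-resp e≗ edgeInj
      , injective-resp (v≗ ∘ inject₁) vertInj )
    , (i , trans (sym (v≗ _)) vᵢ≡v₁)
    , λ (j , vⱼ≡v₂) → ¬visits₂ (j , trans (v≗ _) vⱼ≡v₂) )

  separatingSequences? : ∀ v₁ v₂ k → Dec (∃[ vert ] ∃[ edge ] Separates v₁ v₂ k vert edge)
  separatingSequences? v₁ v₂ k =
    any-fun? (λ v≗ (edge , sep) → edge , separates-resp v≗ (λ _ → refl) sep)
      λ vert → any-fun? (separates-resp {vert = vert} (λ _ → refl)) (separates? v₁ v₂ k vert)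

  -- A cycle with k + 1 distinct vertices has k < |V|, which bounds the search.
  separatingCycle? : ∀ v₁ v₂ → Dec (∃[ C ] (_∈ᵛ_ G v₁ C × ¬ _∈ᵛ_ G v₂ C))
  separatingCycle? v₁ v₂ = map′ toCycle fromCycle (anyUpTo? (separatingSequences? v₁ v₂) nV)
    where
    toCycle : ∃[ k ] (k < nV × ∃[ vert ] ∃[ edge ] Separates v₁ v₂ k vert edge) →
              ∃[ C ] (_∈ᵛ_ G v₁ C × ¬ _∈ᵛ_ G v₂ C)
    toCycle (k , _ , vert , edge , (closed , joins , edgeInj , vertInj) , visits₁ , ¬visits₂) =
      record { k = k ; vert = vert ; edge = edge ; closed = closed ; joins = joins
             ; edgeInj = edgeInj ; vertInj = vertInj } , visits₁ , ¬visits₂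
    fromCycle : ∃[ C ] (_∈ᵛ_ G v₁ C × ¬ _∈ᵛ_ G v₂ C) →
                ∃[ k ] (k < nV × ∃[ vert ] ∃[ edge ] Separates v₁ v₂ k vert edge)
    fromCycle (C , v₁∈C , v₂∉C) = let open Cycle C in
      k , injective⇒≤ vertInj , vert , edge , (closed , joins , edgeInj , vertInj) , v₁∈C , v₂∉C

  ≤*? : Decidable (_≤*_ G)
  ≤*? v₁ v₂ = map′
    (λ ¬sep C v₁∈C → decidable-stable (visits? (Cycle.vert C) v₂) λ v₂∉C → ¬sep (C , v₁∈C , v₂∉C))
    (λ v₁≤v₂ (C , v₁∈C , v₂∉C) → v₂∉C (v₁≤v₂ C v₁∈C))
    (¬? (separatingCycle? v₁ v₂))

  <*? : Decidable (_<*_ G)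
  <*? v₁ v₂ = ≤*? v₁ v₂ ×-dec ¬? (≤*? v₂ v₁)

  <*-noetherian : WellFounded (flip (_<*_ G))
  <*-noetherian = spo-noetherian
    (strictPart-isStrictPartialOrder (λ C v∈C → v∈C) (λ u≤v v≤w C u∈C → v≤w C (u≤v C u∈C)))

  cycleGeneric-above : ∀ {p} (P : Pred (V G) p) → (∀ {u v} → _≤*_ G u v → P u → P v) →
                       ∀ {a} → P a → ∃[ v ] (P v × CycleGeneric G v)
  cycleGeneric-above P upward Pa =
    let v , Pv , v-maximal = maximal-above <*-noetherian <*? P (upward ∘ proj₁) Pa
    in v , Pv , inj₂ v-maximal

proposition3p1 : (G : Graph) (s : ℕ) (Cs : Fin s → Cycle G) →
    (∃[ a ] ((i : Fin s) → _∈ᵛ_ G a (Cs i))) →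
    (∃[ v ] (((i : Fin s) → _∈ᵛ_ G v (Cs i)) × CycleGeneric G v))
    × ((C : Cycle G) → ∃[ v ] (_∈ᵛ_ G v C × CycleGeneric G v))
proposition3p1 G s Cs (a , a∈Cs) =
  cycleGeneric-above G (λ v → ∀ i → _∈ᵛ_ G v (Cs i)) (λ u≤v u∈Cs i → u≤v (Cs i) (u∈Cs i)) a∈Cs ,
  λ C → cycleGeneric-above G (λ v → _∈ᵛ_ G v C) (λ u≤v u∈C → u≤v C u∈C) (zero , refl)
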